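{- Let $n,k$ be natural numbers with $k<n-k$, let $X=\{1,\ldots,n\}$, and let $L_{k,n}=(V,E)$ be the graph with $V=[X]^{k}\cup[X]^{n-k}$ and $E=\{AB : A\in[X]^{k},\ B\in[X]^{n-k},\ A\subseteq B\}$. Let $P=\{1,\ldots,k\}$, $t=n-2k$, and for integers $i$ define $$\gamma(i)=\sum_{j=1}^{t}\binom{k}{k-((i-1)t+j)}\binom{n-k}{(i-1)t+j},\qquad \delta(i)=\sum_{j=1}^{t}\binom{k}{k-((i-1)t+j)}\binom{n-k}{it+j}.$$ Then for every $x\in\{0,1,\ldots,2\lceil k/t\rceil+1\}$, the number of vertices $A\in V$ whose graph distance from $P$ in $L_{k,n}$ equals exactly $x$ is $f(x)$, where $f(x)=\gamma(i)$ if $x=2i$ and $f(x)=\delta(i)$ if $x=2i+1$.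
   Context: $[X]^m$ denotes the set of all $m$-element subsets of $X$. The binomial coefficient is extended to all integers: $\binom{a}{b}=\frac{a!}{b!(a-b)!}$ if $0\leq b\leq a$, and $\binom{a}{b}=0$ if $b<0$ or $b>a$. Graph distance is the length of a shortest path. -}

module Defs where

open import Data.Nat as ℕ using (ℕ; zero; suc; _+_; _*_; _∸_; _<_; _≤_; _≤ᵇ_; _<ᵇ_; _/_)
open import Data.Nat.Combinatorics using (_C_)
open import Data.Integer as ℤ using (ℤ; +_; -[1+_])
open import Data.Bool using (if_then_else_)
open import Data.Fin using (Fin; toℕ)
open import Data.Fin.Subset using (Subset; inside; outside; _⊆_; ∣_∣)
open import Data.Vec using (tabulate)
open import Data.List using (List; map; upTo)
open import Data.Nat.ListAction using (sum)
open import Data.Product using (_×_)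
open import Data.Sum using (_⊎_)
open import Relation.Binary.PropositionalEquality using (_≡_)
open import Relation.Nullary using (¬_)

binomℤ : ℤ → ℤ → ℕ
binomℤ (+ a) (+ b) = if b ≤ᵇ a then a C b else 0
binomℤ (+ a) -[1+ b ] = 0
binomℤ -[1+ a ] b = 0

-- ceiling division ⌈ k / t ⌉ (with the junk value 0 for t = 0, never used since t > 0)
ceilDiv : ℕ → ℕ → ℕ
ceilDiv k zero = 0
ceilDiv k (suc s) = (k + s) / suc s

tt : ℕ → ℕ → ℕ
tt n k = n ∸ (2 * k)

sumFrom1 : ℕ → (ℕ → ℕ) → ℕ
sumFrom1 t g = sum (map (λ j → g (suc j)) (upTo t))

γ : ℕ → ℕ → ℕ → ℕ
γ n k i = sumFrom1 (tt n k) λ j →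
  let m = ((+ i) ℤ.- (+ 1)) ℤ.* (+ tt n k) ℤ.+ (+ j) in
  binomℤ (+ k) ((+ k) ℤ.- m) * binomℤ (+ (n ∸ k)) m

δ : ℕ → ℕ → ℕ → ℕ
δ n k i = sumFrom1 (tt n k) λ j →
  let m = ((+ i) ℤ.- (+ 1)) ℤ.* (+ tt n k) ℤ.+ (+ j)
      m′ = (+ i) ℤ.* (+ tt n k) ℤ.+ (+ j) in
  binomℤ (+ k) ((+ k) ℤ.- m) * binomℤ (+ (n ∸ k)) m′

-- f(x) = γ(i) if x = 2i, δ(i) if x = 2i+1.
-- fAux x i computes f(x + 2i) .
fAux : ℕ → ℕ → ℕ → ℕ → ℕ
fAux n k zero i = γ n k i
fAux n k (suc zero) i = δ n k i
fAux n k (suc (suc x)) i = fAux n k x (suc i)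

f : ℕ → ℕ → ℕ → ℕ
f n k x = fAux n k x 0

IsVertex : (n k : ℕ) → Subset n → Set
IsVertex n k A = ∣ A ∣ ≡ k ⊎ ∣ A ∣ ≡ n ∸ k

Adj : (n k : ℕ) → Subset n → Subset n → Set
Adj n k A B = (∣ A ∣ ≡ k × ∣ B ∣ ≡ n ∸ k × A ⊆ B)
            ⊎ (∣ B ∣ ≡ k × ∣ A ∣ ≡ n ∸ k × B ⊆ A)

data Walk (n k : ℕ) : ℕ → Subset n → Subset n → Set where
  here : ∀ {A} → Walk n k 0 A A
  step : ∀ {l A B C} → Adj n k A B → Walk n k l B C → Walk n k (suc l) A C

Dist : (n k : ℕ) → Subset n → Subset n → ℕ → Set
Dist n k A B x = Walk n k x A B × (∀ m → m < x → ¬ Walk n k m A B)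

-- P = {1,…,k} ⊆ X = {1,…,n}, encoded with Fin n (element i ↦ toℕ i + 1).
Pset : (n k : ℕ) → Subset n
Pset n k = tabulate λ (i : Fin n) → if toℕ i <ᵇ k then inside else outside

module Submission where

-- A subset A is described relative to P by its profile (|A ∩ P|, |A ∖ P|).  The defect
-- of a vertex A is |A ∖ P| if |A| = k and |P ∖ A| if |A| = n - k.  Along an edge the
-- defects change in a controlled way (edge-defects), so that
--   distance(A) = 2⌈defect/t⌉ for k-sets,  2⌈defect/t⌉ + 1 for (n-k)-sets
-- grows by at most one per step and bounds the length of every walk from P; walks
-- attaining it are built by growing and shrinking sets to prescribed profiles.  Hence
-- the sphere of radius 2i (resp. 2i + 1) consists of the k-sets (resp. (n-k)-sets) whose
-- defect lies in one of the t integer slots (i-1)t + j, 1 ≤ j ≤ t.  Each such shell is a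
-- profile class, whose size C(k, k-m) C(n-k, m) (resp. C(k, k-m) C(n-k, t+m)) comes from
-- counting subsets by profile; summing over the slots gives γ(i) (resp. δ(i)).

open import Defs
open import Data.Nat as ℕ using (ℕ; zero; suc; _+_; _*_; _∸_; _≤_; _<_; z≤n; s≤s; s≤s⁻¹; z<s; _≟_; _≤?_; _<?_; _≤ᵇ_; _%_)
open import Data.Nat.Properties
open import Data.Nat.DivMod using (m≡m%n+[m/n]*n; m%n<n)
open import Data.Nat.Combinatorics using (_C_; nCk+nC[k+1]≡[n+1]C[k+1]; k>n⇒nCk≡0)
open import Data.Nat.ListAction using (sum)
open import Data.Integer as ℤ using (ℤ; +_; -[1+_])
import Data.Integer.Properties as ℤ
open import Data.Integer.Tactic.RingSolver using (solve-∀)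
open import Algebra.Bundles using (AbelianGroup)
open import Algebra.Properties.Group (AbelianGroup.group ℤ.+-0-abelianGroup) using (∙-cancelʳ)
open import Data.Bool using (Bool; true; false)
open import Data.Vec using ([]; _∷_)
open import Data.Fin.Subset using (Subset; inside; outside; _⊆_; ∣_∣; _∩_; ∁)
open import Data.Fin.Subset.Properties
  using (out⊆; in⊆in; x∈p∩q⁺; x∈p∩q⁻; p⊆q⇒∣p∣≤∣q∣; ∣p∩q∣≤∣q∣; ∣∁p∣≡n∸∣p∣)
open import Data.List using (List; []; _∷_; _++_; map; filter; length; concat; upTo)
open import Data.List.Properties using (filter-++; filter-≐; filter-none; length-++; length-map; map-cong; map-∘)
open import Data.List.Membership.Propositional using (_∈_)
open import Data.List.Membership.Propositional.Properties
  using (∈-++⁺ˡ; ∈-++⁺ʳ; ∈-map⁺; ∈-map⁻; ∈-concat⁺′; ∈-concat⁻′; ∈-filter⁺; ∈-filter⁻; ∈-upTo⁺; ∈-upTo⁻)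
open import Data.List.Relation.Unary.Any using (here)
import Data.List.Relation.Unary.All as All
import Data.List.Relation.Unary.All.Properties as All
open import Data.List.Relation.Unary.AllPairs using ([]; _∷_)
import Data.List.Relation.Unary.AllPairs as AllPairs
import Data.List.Relation.Unary.AllPairs.Properties as AllPairs
open import Data.List.Relation.Unary.Unique.Propositional using (Unique)
import Data.List.Relation.Unary.Unique.Propositional.Properties as Unique
open import Data.Product using (Σ; _×_; _,_; proj₁; proj₂)
open import Data.Sum using (inj₁; inj₂)
open import Relation.Binary.PropositionalEquality
open import Relation.Nullary using (¬_; yes; no; contradiction)
open import Relation.Nullary.Decidable using (_×-dec_)
open import Relation.Unary using (Pred; Decidable)
open import Function.Bundles using (_⇔_; mk⇔; Equivalence)

Profile : ∀ {n} → Subset n → ℕ → ℕ → Subset n → Set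
Profile P p q A = ∣ A ∩ P ∣ ≡ p × ∣ A ∩ ∁ P ∣ ≡ q

profile? : ∀ {n} (P : Subset n) p q → Decidable (Profile P p q)
profile? P p q A = (∣ A ∩ P ∣ ≟ p) ×-dec (∣ A ∩ ∁ P ∣ ≟ q)

∣∣-split : ∀ {n} (P A : Subset n) → ∣ A ∣ ≡ ∣ A ∩ P ∣ + ∣ A ∩ ∁ P ∣
∣∣-split []            []            = refl
∣∣-split (inside  ∷ P) (inside  ∷ A) = cong suc (∣∣-split P A)
∣∣-split (outside ∷ P) (inside  ∷ A) = trans (cong suc (∣∣-split P A)) (sym (+-suc _ _))
∣∣-split (_       ∷ P) (outside ∷ A) = ∣∣-split P A

∣∩∣-mono : ∀ {n} {A B : Subset n} (Q : Subset n) → A ⊆ B → ∣ A ∩ Q ∣ ≤ ∣ B ∩ Q ∣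
∣∩∣-mono {A = A} Q A⊆B = p⊆q⇒∣p∣≤∣q∣ λ x∈A∩Q →
  let (x∈A , x∈Q) = x∈p∩q⁻ A Q x∈A∩Q in x∈p∩q⁺ (A⊆B x∈A , x∈Q)

∣P∩∁P∣≡0 : ∀ {n} (P : Subset n) → ∣ P ∩ ∁ P ∣ ≡ 0
∣P∩∁P∣≡0 []            = refl
∣P∩∁P∣≡0 (inside  ∷ P) = ∣P∩∁P∣≡0 P
∣P∩∁P∣≡0 (outside ∷ P) = ∣P∩∁P∣≡0 P

profile⇒≡P : ∀ {n} (P A : Subset n) → ∣ A ∩ ∁ P ∣ ≡ 0 → ∣ A ∩ P ∣ ≡ ∣ P ∣ → A ≡ P
profile⇒≡P []            []            _  _  = refl
profile⇒≡P (inside  ∷ P) (inside  ∷ A) e₀ e = cong (inside ∷_) (profile⇒≡P P A e₀ (suc-injective e))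
profile⇒≡P (inside  ∷ P) (outside ∷ A) e₀ e =
  contradiction (subst (_≤ ∣ P ∣) e (∣p∩q∣≤∣q∣ A P)) (<⇒≱ ≤-refl)
profile⇒≡P (outside ∷ P) (outside ∷ A) e₀ e = cong (outside ∷_) (profile⇒≡P P A e₀ e)
profile⇒≡P (outside ∷ P) (inside  ∷ A) () e

shrink : ∀ {n} (P B : Subset n) p q → p ≤ ∣ B ∩ P ∣ → q ≤ ∣ B ∩ ∁ P ∣ →
         Σ (Subset n) λ A → A ⊆ B × Profile P p q A
shrink []            []            zero    zero    _         _         = [] , (λ x → x) , refl , refl
shrink (inside  ∷ P) (inside  ∷ B) zero    q       _         q≤        =
  let (A , A⊆B , e , e′) = shrink P B zero q z≤n q≤ in outside ∷ A , out⊆ A⊆B , e , e′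
shrink (inside  ∷ P) (inside  ∷ B) (suc p) q       (s≤s p≤)  q≤        =
  let (A , A⊆B , e , e′) = shrink P B p q p≤ q≤ in inside ∷ A , in⊆in A⊆B , cong suc e , e′
shrink (outside ∷ P) (inside  ∷ B) p       zero    p≤        _         =
  let (A , A⊆B , e , e′) = shrink P B p zero p≤ z≤n in outside ∷ A , out⊆ A⊆B , e , e′
shrink (outside ∷ P) (inside  ∷ B) p       (suc q) p≤        (s≤s q≤)  =
  let (A , A⊆B , e , e′) = shrink P B p q p≤ q≤ in inside ∷ A , in⊆in A⊆B , e , cong suc e′
shrink (_       ∷ P) (outside ∷ B) p       q       p≤        q≤        =
  let (A , A⊆B , e , e′) = shrink P B p q p≤ q≤ in outside ∷ A , out⊆ A⊆B , e , e′

-- Where A misses an element of P we add it exactly when the remaining part of P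
-- is too small to reach the target otherwise; likewise outside P.
grow : ∀ {n} (P A : Subset n) p q → ∣ A ∩ P ∣ ≤ p → p ≤ ∣ P ∣ → ∣ A ∩ ∁ P ∣ ≤ q → q ≤ ∣ ∁ P ∣ →
       Σ (Subset n) λ B → A ⊆ B × Profile P p q B
grow []            []            zero    zero    _ _ _ _ = [] , (λ x → x) , refl , refl
grow (inside  ∷ P) (inside  ∷ A) (suc p) q (s≤s a≤p) (s≤s p≤) a≤q q≤ =
  let (B , A⊆B , e , e′) = grow P A p q a≤p p≤ a≤q q≤ in inside ∷ B , in⊆in A⊆B , cong suc e , e′
grow (outside ∷ P) (inside  ∷ A) p (suc q) a≤p p≤ (s≤s a≤q) (s≤s q≤) =
  let (B , A⊆B , e , e′) = grow P A p q a≤p p≤ a≤q q≤ in inside ∷ B , in⊆in A⊆B , e , cong suc e′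
grow (inside  ∷ P) (outside ∷ A) p q a≤p p≤ a≤q q≤ with p ≤? ∣ P ∣
... | yes p≤′ = let (B , A⊆B , e , e′) = grow P A p q a≤p p≤′ a≤q q≤ in outside ∷ B , out⊆ A⊆B , e , e′
... | no p≰ =
  let (B , A⊆B , e , e′) = grow P A ∣ P ∣ q (∣p∩q∣≤∣q∣ A P) ≤-refl a≤q q≤
  in inside ∷ B , out⊆ A⊆B , trans (cong suc e) (≤-antisym (≰⇒> p≰) p≤) , e′
grow (outside ∷ P) (outside ∷ A) p q a≤p p≤ a≤q q≤ with q ≤? ∣ ∁ P ∣
... | yes q≤′ = let (B , A⊆B , e , e′) = grow P A p q a≤p p≤ a≤q q≤′ in outside ∷ B , out⊆ A⊆B , e , e′
... | no q≰ =
  let (B , A⊆B , e , e′) = grow P A p ∣ ∁ P ∣ a≤p p≤ (∣p∩q∣≤∣q∣ A (∁ P)) ≤-refl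
  in inside ∷ B , out⊆ A⊆B , e , trans (cong suc e′) (≤-antisym (≰⇒> q≰) q≤)

filter-map : ∀ {a b p} {X : Set a} {Y : Set b} {Q : Pred Y p} (Q? : Decidable Q) (g : X → Y) xs →
             filter Q? (map g xs) ≡ map g (filter (λ x → Q? (g x)) xs)
filter-map Q? g []       = refl
filter-map Q? g (x ∷ xs) with Q? (g x)
... | yes _ = cong (g x ∷_) (filter-map Q? g xs)
... | no  _ = filter-map Q? g xs

length-filter-none : ∀ {a p} {X : Set a} {Q : Pred X p} (Q? : Decidable Q) →
                     (∀ x → ¬ Q x) → ∀ xs → length (filter Q? xs) ≡ 0
length-filter-none Q? none xs = cong length (filter-none Q? {xs} (All.tabulate λ {x} _ → none x))

module _ {a b} {I : Set a} {X : Set b} (F : I → List X) where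

  ∈-concatMap⇔ : ∀ is {x} → x ∈ concat (map F is) ⇔ (Σ I λ i → i ∈ is × x ∈ F i)
  ∈-concatMap⇔ is = mk⇔ to from
    where
    to : ∀ {x} → x ∈ concat (map F is) → Σ I λ i → i ∈ is × x ∈ F i
    to x∈ with ∈-concat⁻′ (map F is) x∈
    ... | xs , x∈xs , xs∈ with ∈-map⁻ F xs∈
    ...   | i , i∈is , refl = i , i∈is , x∈xs
    from : ∀ {x} → (Σ I λ i → i ∈ is × x ∈ F i) → x ∈ concat (map F is)
    from (i , i∈is , x∈Fi) = ∈-concat⁺′ x∈Fi (∈-map⁺ F i∈is)

  concatMap-unique : ∀ {is} → Unique is → (∀ i → Unique (F i)) →
                     (∀ {i i′ x} → x ∈ F i → x ∈ F i′ → i ≡ i′) → Unique (concat (map F is))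
  concatMap-unique is! F! separated =
    Unique.concat⁺ (All.map⁺ (All.tabulate λ {i} _ → F! i))
                   (AllPairs.map⁺ {f = F} (AllPairs.map (λ i≢i′ {x} (x∈ , x∈′) → i≢i′ (separated x∈ x∈′)) is!))

length-concat : ∀ {a} {X : Set a} (xss : List (List X)) → length (concat xss) ≡ sum (map length xss)
length-concat []         = refl
length-concat (xs ∷ xss) = trans (length-++ xs) (cong (λ m → length xs + m) (length-concat xss))

subsets : ∀ n → List (Subset n)
subsets zero    = [] ∷ []
subsets (suc n) = map (inside ∷_) (subsets n) ++ map (outside ∷_) (subsets n)

∈-subsets : ∀ {n} (A : Subset n) → A ∈ subsets n
∈-subsets []            = here refl
∈-subsets (inside  ∷ A) = ∈-++⁺ˡ (∈-map⁺ (inside ∷_) (∈-subsets A))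
∈-subsets (outside ∷ A) = ∈-++⁺ʳ (map (inside ∷_) (subsets _)) (∈-map⁺ (outside ∷_) (∈-subsets A))

subsets-unique : ∀ n → Unique (subsets n)
subsets-unique zero    = All.[] ∷ []
subsets-unique (suc n) =
  Unique.++⁺ (Unique.map⁺ ∷-injectiveʳ (subsets-unique n)) (Unique.map⁺ ∷-injectiveʳ (subsets-unique n)) heads-differ
  where
  ∷-injectiveʳ : ∀ {b : Bool} {A B : Subset n} → b ∷ A ≡ b ∷ B → A ≡ B
  ∷-injectiveʳ refl = refl
  heads-differ : ∀ {A} → ¬ (A ∈ map (inside ∷_) (subsets n) × A ∈ map (outside ∷_) (subsets n))
  heads-differ (A∈ , A∈′) with ∈-map⁻ (inside ∷_) A∈ | ∈-map⁻ (outside ∷_) A∈′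
  ... | _ , _ , refl | _ , _ , ()

#profile : ∀ {n} (P : Subset n) → ℕ → ℕ → ℕ
#profile {n} P p q = length (filter (profile? P p q) (subsets n))

#profile-∷ : ∀ {n} b (P : Subset n) p q →
  #profile (b ∷ P) p q ≡ length (filter (λ A → profile? (b ∷ P) p q (inside ∷ A)) (subsets n)) + #profile P p q
#profile-∷ {n} b P p q = begin
  length (filter Q? (map (inside ∷_) S ++ map (outside ∷_) S))
    ≡⟨ cong length (filter-++ Q? (map (inside ∷_) S) _) ⟩
  length (filter Q? (map (inside ∷_) S) ++ filter Q? (map (outside ∷_) S))
    ≡⟨ length-++ (filter Q? (map (inside ∷_) S)) ⟩
  length (filter Q? (map (inside ∷_) S)) + length (filter Q? (map (outside ∷_) S))
    ≡⟨ cong₂ _+_ (pull (inside ∷_)) (pull (outside ∷_)) ⟩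
  length (filter (λ A → Q? (inside ∷ A)) S) + #profile P p q ∎
  where
  open ≡-Reasoning
  S = subsets n
  Q? = profile? (b ∷ P) p q
  pull : ∀ g → length (filter Q? (map g S)) ≡ length (filter (λ A → Q? (g A)) S)
  pull g = trans (cong length (filter-map Q? g S)) (length-map g (filter (λ A → Q? (g A)) S))

-- There are C(|P|, p) C(|∁P|, q) subsets of profile (p, q): choose p elements of P and
-- q elements outside P.  Induction on P, using Pascal's rule for the first coordinate.
#profile≡ : ∀ {n} (P : Subset n) p q → #profile P p q ≡ (∣ P ∣ C p) * (∣ ∁ P ∣ C q)
#profile≡ []            zero    zero    = refl
#profile≡ []            zero    (suc q) = refl
#profile≡ []            (suc p) q       = refl
#profile≡ {suc n} (inside ∷ P) p q = begin
  #profile (inside ∷ P) p q                       ≡⟨ #profile-∷ inside P p q ⟩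
  length (filter (λ A → Q? (inside ∷ A)) S) + #profile P p q ≡⟨ cong₂ _+_ (with-head p) (#profile≡ P p q) ⟩
  head-term p + (∣ P ∣ C p) * (∣ ∁ P ∣ C q)          ≡⟨ pascal p ⟩
  (suc ∣ P ∣ C p) * (∣ ∁ P ∣ C q) ∎
  where
  open ≡-Reasoning
  S = subsets n
  Q? = profile? (inside ∷ P) p q
  head-term : ℕ → ℕ
  head-term zero    = 0
  head-term (suc p) = (∣ P ∣ C p) * (∣ ∁ P ∣ C q)
  with-head : ∀ p → length (filter (λ A → profile? (inside ∷ P) p q (inside ∷ A)) S) ≡ head-term p
  with-head zero    = length-filter-none (λ A → profile? (inside ∷ P) 0 q (inside ∷ A)) (λ _ ()) S
  with-head (suc p) = trans (cong length (filter-≐ _ (profile? P p q)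
                        ((λ (e , e′) → suc-injective e , e′) , (λ (e , e′) → cong suc e , e′)) S)) (#profile≡ P p q)
  pascal : ∀ p → head-term p + (∣ P ∣ C p) * (∣ ∁ P ∣ C q) ≡ (suc ∣ P ∣ C p) * (∣ ∁ P ∣ C q)
  pascal zero    = refl
  pascal (suc p) = trans (sym (*-distribʳ-+ (∣ ∁ P ∣ C q) (∣ P ∣ C p) _))
                         (cong (_* (∣ ∁ P ∣ C q)) (nCk+nC[k+1]≡[n+1]C[k+1] ∣ P ∣ p))
#profile≡ {suc n} (outside ∷ P) p q = begin
  #profile (outside ∷ P) p q                       ≡⟨ #profile-∷ outside P p q ⟩
  length (filter (λ A → Q? (inside ∷ A)) S) + #profile P p q ≡⟨ cong₂ _+_ (with-head q) (#profile≡ P p q) ⟩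
  (∣ P ∣ C p) * head-term q + (∣ P ∣ C p) * (∣ ∁ P ∣ C q) ≡⟨ pascal q ⟩
  (∣ P ∣ C p) * (suc ∣ ∁ P ∣ C q) ∎
  where
  open ≡-Reasoning
  S = subsets n
  Q? = profile? (outside ∷ P) p q
  head-term : ℕ → ℕ
  head-term zero    = 0
  head-term (suc q) = ∣ ∁ P ∣ C q
  with-head : ∀ q → length (filter (λ A → profile? (outside ∷ P) p q (inside ∷ A)) S) ≡ (∣ P ∣ C p) * head-term q
  with-head zero    = trans (length-filter-none (λ A → profile? (outside ∷ P) p 0 (inside ∷ A)) (λ _ ()) S)
                            (sym (*-zeroʳ (∣ P ∣ C p)))
  with-head (suc q) = trans (cong length (filter-≐ _ (profile? P p q)
                        ((λ (e , e′) → e , suc-injective e′) , (λ (e , e′) → e , cong suc e′)) S)) (#profile≡ P p q)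
  pascal : ∀ q → (∣ P ∣ C p) * head-term q + (∣ P ∣ C p) * (∣ ∁ P ∣ C q) ≡ (∣ P ∣ C p) * (suc ∣ ∁ P ∣ C q)
  pascal zero    = cong (_+ (∣ P ∣ C p) * 1) (*-zeroʳ (∣ P ∣ C p))
  pascal (suc q) = trans (sym (*-distribˡ-+ (∣ P ∣ C p) (∣ ∁ P ∣ C q) _))
                         (cong ((∣ P ∣ C p) *_) (nCk+nC[k+1]≡[n+1]C[k+1] ∣ ∁ P ∣ q))

slot : ℕ → ℕ → ℕ → ℤ
slot t i j = ((+ i) ℤ.- (+ 1)) ℤ.* (+ t) ℤ.+ (+ j)

t+slot : ∀ t i j → + t ℤ.+ slot t i j ≡ + i ℤ.* + t ℤ.+ + j
t+slot t i j = shift (+ i) (+ t) (+ j)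
  where
  shift : ∀ a b c → b ℤ.+ ((a ℤ.- + 1) ℤ.* b ℤ.+ c) ≡ a ℤ.* b ℤ.+ c
  shift = solve-∀

module Ceiling (s : ℕ) where

  t : ℕ
  t = suc s

  IsCeil : ℕ → ℕ → Set
  IsCeil i m = m ≤ i * t × i * t < m + t

  ceilDiv-isCeil : ∀ m → IsCeil (ceilDiv m t) m
  ceilDiv-isCeil m = m≤qt , qt<m+t
    where
    q = ceilDiv m t
    r = (m + s) % t
    division : m + s ≡ r + q * t
    division = m≡m%n+[m/n]*n (m + s) t
    r≤s : r ≤ s
    r≤s = s≤s⁻¹ (m%n<n (m + s) t)
    open ≤-Reasoning
    m≤qt : m ≤ q * t
    m≤qt = +-cancelʳ-≤ s m (q * t) (begin
      m + s     ≡⟨ division ⟩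
      r + q * t ≤⟨ +-monoˡ-≤ (q * t) r≤s ⟩
      s + q * t ≡⟨ +-comm s (q * t) ⟩
      q * t + s ∎)
    qt<m+t : q * t < m + t
    qt<m+t = begin-strict
      q * t     ≤⟨ m≤n+m (q * t) r ⟩
      r + q * t ≡⟨ division ⟨
      m + s     <⟨ +-monoʳ-< m (n<1+n s) ⟩
      m + t     ∎

  isCeil-least : ∀ {i m} j → IsCeil i m → m ≤ j * t → i ≤ j
  isCeil-least {i} {m} j (_ , it<m+t) m≤jt with i ≤? j
  ... | yes i≤j = i≤j
  ... | no  i≰j = contradiction it<m+t (≤⇒≯ (begin
      m + t     ≤⟨ +-monoˡ-≤ t m≤jt ⟩
      j * t + t ≡⟨ +-comm (j * t) t ⟩
      suc j * t ≤⟨ *-monoˡ-≤ t (≰⇒> i≰j) ⟩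
      i * t     ∎))
    where open ≤-Reasoning

  isCeil⇒ceilDiv : ∀ {i m} → IsCeil i m → ceilDiv m t ≡ i
  isCeil⇒ceilDiv {i} {m} isCeil =
    ≤-antisym (isCeil-least i (ceilDiv-isCeil m) (proj₁ isCeil))
              (isCeil-least (ceilDiv m t) isCeil (proj₁ (ceilDiv-isCeil m)))

  ceilDiv-mono : ∀ {m m′} → m ≤ m′ → ceilDiv m t ≤ ceilDiv m′ t
  ceilDiv-mono {m} {m′} m≤m′ =
    isCeil-least (ceilDiv m′ t) (ceilDiv-isCeil m) (≤-trans m≤m′ (proj₁ (ceilDiv-isCeil m′)))

  ceilDiv-step : ∀ {m m′} → m′ ≤ t + m → ceilDiv m′ t ≤ suc (ceilDiv m t)
  ceilDiv-step {m} {m′} m′≤t+m =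
    isCeil-least (suc (ceilDiv m t)) (ceilDiv-isCeil m′) (≤-trans m′≤t+m (+-monoʳ-≤ t (proj₁ (ceilDiv-isCeil m))))

  ceilDiv-zero : ceilDiv 0 t ≡ 0
  ceilDiv-zero = n≤0⇒n≡0 (isCeil-least 0 (ceilDiv-isCeil 0) z≤n)

  isCeil-pred : ∀ {i m} → IsCeil (suc i) m → IsCeil i (m ∸ t)
  isCeil-pred {i} {m} (m≤t+it , t+it<m+t) =
    m≤n+o⇒m∸n≤o m t m≤t+it ,
    ≤-trans (+-cancelˡ-< t (i * t) m (subst (t + i * t <_) (+-comm m t) t+it<m+t))
            (subst (m ≤_) (+-comm t (m ∸ t)) (m≤n+m∸n m t))

  slot+t : ∀ i j → slot t i j ℤ.+ + t ≡ + (i * t + j)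
  slot+t i j = trans (ℤ.+-comm (slot t i j) (+ t)) (trans (t+slot t i j) (cong (ℤ._+ + j) (ℤ.+◃n≡+n (i * t))))

  slot⇔ : ∀ i j m → (+ m ≡ slot t i j) ⇔ (m + t ≡ i * t + j)
  slot⇔ i j m = mk⇔
    (λ m≡slot → ℤ.+-injective (trans (cong (ℤ._+ + t) m≡slot) (slot+t i j)))
    (λ m+t≡ → ∙-cancelʳ (+ t) (+ m) (slot t i j) (trans (cong +_ m+t≡) (sym (slot+t i j))))

  isCeil⇔slot : ∀ i m → IsCeil i m ⇔ (Σ ℕ λ j → j < t × + m ≡ slot t i (suc j))
  isCeil⇔slot i m = mk⇔ to from
    where
    to : IsCeil i m → Σ ℕ λ j → j < t × + m ≡ slot t i (suc j)
    to (m≤it , it<m+t) = j , j<t , Equivalence.from (slot⇔ i (suc j) m) m+t≡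
      where
      j = m + t ∸ suc (i * t)
      m+t≡ : m + t ≡ i * t + suc j
      m+t≡ = trans (sym (m+[n∸m]≡n it<m+t)) (sym (+-suc (i * t) j))
      j<t : j < t
      j<t = +-cancelˡ-≤ (i * t) (suc j) t (subst (_≤ i * t + t) m+t≡ (+-monoˡ-≤ t m≤it))
    from : (Σ ℕ λ j → j < t × + m ≡ slot t i (suc j)) → IsCeil i m
    from (j , j<t , m≡slot) =
      +-cancelʳ-≤ t m (i * t) (subst (_≤ i * t + t) (sym m+t≡) (+-monoʳ-≤ (i * t) j<t)) ,
      subst (i * t <_) (sym m+t≡) (m<m+n (i * t) z<s)
      where
      m+t≡ : m + t ≡ i * t + suc j
      m+t≡ = Equivalence.to (slot⇔ i (suc j) m) m≡slot

  slot-injective : ∀ i {j j′} → slot t i j ≡ slot t i j′ → j ≡ j′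
  slot-injective i {j} {j′} e = +-cancelˡ-≡ (i * t) j j′ (ℤ.+-injective
    (trans (sym (slot+t i j)) (trans (cong (ℤ._+ + t) e) (slot+t i j′))))

binomℤ-ℕ : ∀ a b → binomℤ (+ a) (+ b) ≡ a C b
binomℤ-ℕ a b with b ≤ᵇ a
... | true  = refl
... | false = refl

binomℤ-co : ∀ a c → c ≤ a → binomℤ (+ a) (+ a ℤ.- + c) ≡ a C (a ∸ c)
binomℤ-co a c c≤a = trans (cong (binomℤ (+ a)) (trans (ℤ.m-n≡m⊖n a c) (ℤ.⊖-≥ c≤a))) (binomℤ-ℕ a (a ∸ c))

binomℤ-co-large : ∀ a c → a < c → binomℤ (+ a) (+ a ℤ.- + c) ≡ 0
binomℤ-co-large a c a<c = trans (cong (binomℤ (+ a)) (trans (ℤ.m-n≡m⊖n a c) (ℤ.⊖-< a<c)))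
                                (negative (c ∸ a) (m<n⇒0<n∸m a<c))
  where
  negative : ∀ m → 0 < m → binomℤ (+ a) (ℤ.- (+ m)) ≡ 0
  negative (suc m) _ = refl

-- For negative m the index k - m exceeds k, so C(k, k - m) vanishes too.
binomℤ-co-neg : ∀ a c → binomℤ (+ a) (+ a ℤ.- -[1+ c ]) ≡ 0
binomℤ-co-neg a c = trans (binomℤ-ℕ a (a + suc c)) (k>n⇒nCk≡0 (m<m+n a z<s))

-- The two layers [X]^k and [X]^{n-k} of L_{k,n}; distances to the upper layer are odd.
data Layer : Set where
  lower upper : Layer

parity : Layer → ℕ
parity lower = 0
parity upper = 1

parity-split : ∀ ℓ ℓ′ a b → parity ℓ + 2 * a ≡ parity ℓ′ + 2 * b → ℓ ≡ ℓ′ × a ≡ b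
parity-split lower lower a b e = refl , *-cancelˡ-≡ a b 2 e
parity-split upper upper a b e = refl , *-cancelˡ-≡ a b 2 (suc-injective e)
parity-split lower upper a b e = contradiction e (even≢odd a b)
parity-split upper lower a b e = contradiction (sym e) (even≢odd b a)

-- The second binomial index of a shell count: the defect m on the lower layer,
-- t + m (the number of elements outside P) on the upper one.
outsideShift : ℕ → Layer → ℤ → ℤ
outsideShift t lower m = m
outsideShift t upper m = + t ℤ.+ m

-- The number of vertices of layer ℓ at distance parity ℓ + 2i: the sum of the shell
-- counts over the t slots of level i.
sphereCount : (n k t : ℕ) → Layer → ℕ → ℕ
sphereCount n k t ℓ i = sumFrom1 t λ j →
  binomℤ (+ k) (+ k ℤ.- slot t i j) * binomℤ (+ (n ∸ k)) (outsideShift t ℓ (slot t i j))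

module DistancesFrom (n k s : ℕ) (P : Subset n) (∣P∣≡k : ∣ P ∣ ≡ k) (n∸k≡t+k : n ∸ k ≡ suc s + k) where

  open Ceiling s

  layerSize : Layer → ℕ
  layerSize lower = k
  layerSize upper = n ∸ k

  defect : Layer → Subset n → ℕ
  defect lower A = ∣ A ∩ ∁ P ∣
  defect upper A = k ∸ ∣ A ∩ P ∣

  layerDistance : Layer → Subset n → ℕ
  layerDistance ℓ A = parity ℓ + 2 * ceilDiv (defect ℓ A) t

  distance : Subset n → ℕ
  distance A with ∣ A ∣ ≟ k
  ... | yes _ = layerDistance lower A
  ... | no  _ = layerDistance upper A

  k≢n∸k : k ≢ n ∸ k
  k≢n∸k k≡n∸k = m≢1+n+m k (trans k≡n∸k n∸k≡t+k)

  distance-on : ∀ ℓ A → ∣ A ∣ ≡ layerSize ℓ → distance A ≡ layerDistance ℓ A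
  distance-on lower A ∣A∣≡k with ∣ A ∣ ≟ k
  ... | yes _     = refl
  ... | no ∣A∣≢k  = contradiction ∣A∣≡k ∣A∣≢k
  distance-on upper A ∣A∣≡n∸k with ∣ A ∣ ≟ k
  ... | yes ∣A∣≡k = contradiction (trans (sym ∣A∣≡k) ∣A∣≡n∸k) k≢n∸k
  ... | no  _     = refl

  ∣∩P∣≤k : ∀ A → ∣ A ∩ P ∣ ≤ k
  ∣∩P∣≤k A = subst (∣ A ∩ P ∣ ≤_) ∣P∣≡k (∣p∩q∣≤∣q∣ A P)

  ∣∁P∣≡n∸k : ∣ ∁ P ∣ ≡ n ∸ k
  ∣∁P∣≡n∸k = trans (∣∁p∣≡n∸∣p∣ P) (cong (n ∸_) ∣P∣≡k)

  upper-outside : ∀ B → ∣ B ∣ ≡ n ∸ k → ∣ B ∩ ∁ P ∣ ≡ t + defect upper B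
  upper-outside B ∣B∣≡n∸k = begin
    ∣ B ∩ ∁ P ∣                          ≡⟨ m+n∸m≡n ∣ B ∩ P ∣ ∣ B ∩ ∁ P ∣ ⟨
    ∣ B ∩ P ∣ + ∣ B ∩ ∁ P ∣ ∸ ∣ B ∩ P ∣  ≡⟨ cong (_∸ ∣ B ∩ P ∣) (trans (sym (∣∣-split P B)) (trans ∣B∣≡n∸k n∸k≡t+k)) ⟩
    t + k ∸ ∣ B ∩ P ∣                    ≡⟨ +-∸-assoc t (∣∩P∣≤k B) ⟩
    t + (k ∸ ∣ B ∩ P ∣)                  ∎
    where open ≡-Reasoning

  edge-defects : ∀ {A B} → ∣ A ∣ ≡ k → ∣ B ∣ ≡ n ∸ k → A ⊆ B →
                 defect upper B ≤ defect lower A × defect lower A ≤ t + defect upper B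
  edge-defects {A} {B} ∣A∣≡k ∣B∣≡n∸k A⊆B = lower-bound , upper-bound
    where
    open ≤-Reasoning
    lower-bound : k ∸ ∣ B ∩ P ∣ ≤ ∣ A ∩ ∁ P ∣
    lower-bound = begin
      k ∸ ∣ B ∩ P ∣                         ≤⟨ ∸-monoʳ-≤ k (∣∩∣-mono P A⊆B) ⟩
      k ∸ ∣ A ∩ P ∣                         ≡⟨ cong (_∸ ∣ A ∩ P ∣) (trans (sym ∣A∣≡k) (∣∣-split P A)) ⟩
      ∣ A ∩ P ∣ + ∣ A ∩ ∁ P ∣ ∸ ∣ A ∩ P ∣   ≡⟨ m+n∸m≡n ∣ A ∩ P ∣ ∣ A ∩ ∁ P ∣ ⟩
      ∣ A ∩ ∁ P ∣                           ∎
    upper-bound : ∣ A ∩ ∁ P ∣ ≤ t + (k ∸ ∣ B ∩ P ∣)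
    upper-bound = subst (∣ A ∩ ∁ P ∣ ≤_) (upper-outside B ∣B∣≡n∸k) (∣∩∣-mono (∁ P) A⊆B)

  distance-edge : ∀ {A B} → Adj n k A B → distance B ≤ suc (distance A)
  distance-edge {A} {B} (inj₁ (∣A∣≡k , ∣B∣≡n∸k , A⊆B)) = begin
    distance B                              ≡⟨ distance-on upper B ∣B∣≡n∸k ⟩
    suc (2 * ceilDiv (defect upper B) t)    ≤⟨ s≤s (*-monoʳ-≤ 2 (ceilDiv-mono dB≤dA)) ⟩
    suc (2 * ceilDiv (defect lower A) t)    ≡⟨ cong suc (distance-on lower A ∣A∣≡k) ⟨
    suc (distance A)                        ∎
    where
    open ≤-Reasoning
    dB≤dA = proj₁ (edge-defects ∣A∣≡k ∣B∣≡n∸k A⊆B)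
  distance-edge {A} {B} (inj₂ (∣B∣≡k , ∣A∣≡n∸k , B⊆A)) = begin
    distance B                              ≡⟨ distance-on lower B ∣B∣≡k ⟩
    2 * ceilDiv (defect lower B) t          ≤⟨ *-monoʳ-≤ 2 (ceilDiv-step dB≤t+dA) ⟩
    2 * suc (ceilDiv (defect upper A) t)    ≡⟨ *-distribˡ-+ 2 1 (ceilDiv (defect upper A) t) ⟩
    suc (suc (2 * ceilDiv (defect upper A) t)) ≡⟨ cong suc (distance-on upper A ∣A∣≡n∸k) ⟨
    suc (distance A)                        ∎
    where
    open ≤-Reasoning
    dB≤t+dA = proj₂ (edge-defects ∣B∣≡k ∣A∣≡n∸k B⊆A)

  distance-walk : ∀ {l A B} → Walk n k l A B → distance B ≤ distance A + l
  distance-walk {A = A} here = m≤m+n (distance A) 0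
  distance-walk {suc l} {A} {C} (step {B = B} adj walk) = begin
    distance C            ≤⟨ distance-walk walk ⟩
    distance B + l        ≤⟨ +-monoˡ-≤ l (distance-edge adj) ⟩
    suc (distance A) + l  ≡⟨ +-suc (distance A) l ⟨
    distance A + suc l    ∎
    where open ≤-Reasoning

  upper-size : ∀ d → d ≤ k → (k ∸ d) + (t + d) ≡ n ∸ k
  upper-size d d≤k = begin
    (k ∸ d) + (t + d)  ≡⟨ +-comm (k ∸ d) (t + d) ⟩
    t + d + (k ∸ d)    ≡⟨ +-assoc t d (k ∸ d) ⟩
    t + (d + (k ∸ d))  ≡⟨ cong (λ m → t + m) (m+[n∸m]≡n d≤k) ⟩
    t + k              ≡⟨ n∸k≡t+k ⟨
    n ∸ k              ∎
    where open ≡-Reasoning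

  walk-snoc : ∀ {l A B C} → Walk n k l A B → Adj n k B C → Walk n k (suc l) A C
  walk-snoc here         adj′ = step adj′ here
  walk-snoc (step adj w) adj′ = step adj (walk-snoc w adj′)

  lower-inside : ∀ A → ∣ A ∣ ≡ k → ∣ A ∩ P ∣ ≡ k ∸ defect lower A
  lower-inside A ∣A∣≡k = trans (sym (m+n∸n≡m ∣ A ∩ P ∣ ∣ A ∩ ∁ P ∣))
                               (cong (_∸ ∣ A ∩ ∁ P ∣) (trans (sym (∣∣-split P A)) ∣A∣≡k))

  defect≤k : ∀ ℓ A → ∣ A ∣ ≡ layerSize ℓ → defect ℓ A ≤ k
  defect≤k lower A ∣A∣≡k = subst (∣ A ∩ ∁ P ∣ ≤_) (trans (sym (∣∣-split P A)) ∣A∣≡k) (m≤n+m ∣ A ∩ ∁ P ∣ ∣ A ∩ P ∣)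
  defect≤k upper A _     = m∸n≤m k ∣ A ∩ P ∣

  -- Reaching a vertex whose defect has ceiling i takes 2i steps (k-sets) or 2i+1 steps
  -- ((n-k)-sets): an (n-k)-set B is entered from the k-set formed by B ∩ P plus
  -- (defect of B) of its other elements, which has the same defect; a k-set A of
  -- defect c is entered from an (n-k)-superset of defect c - t.
  walk-to-lower : ∀ i A → ∣ A ∣ ≡ k → IsCeil i (defect lower A) → Walk n k (2 * i) P A
  walk-to-upper : ∀ i B → ∣ B ∣ ≡ n ∸ k → IsCeil i (defect upper B) → Walk n k (suc (2 * i)) P B

  walk-to-upper i B ∣B∣≡n∸k isCeil =
    walk-snoc (walk-to-lower i A ∣A∣≡k (subst (IsCeil i) (sym outside≡d) isCeil)) (inj₁ (∣A∣≡k , ∣B∣≡n∸k , A⊆B))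
    where
    d = defect upper B
    chosen = shrink P B ∣ B ∩ P ∣ d ≤-refl (subst (d ≤_) (sym (upper-outside B ∣B∣≡n∸k)) (m≤n+m d t))
    A = proj₁ chosen
    A⊆B = proj₁ (proj₂ chosen)
    outside≡d : ∣ A ∩ ∁ P ∣ ≡ d
    outside≡d = proj₂ (proj₂ (proj₂ chosen))
    ∣A∣≡k : ∣ A ∣ ≡ k
    ∣A∣≡k = trans (∣∣-split P A) (trans (cong₂ _+_ (proj₁ (proj₂ (proj₂ chosen))) outside≡d) (m+[n∸m]≡n (∣∩P∣≤k B)))

  walk-to-lower zero A ∣A∣≡k (c≤0 , _) = subst (Walk n k 0 P) (sym A≡P) here
    where
    A≡P : A ≡ P
    A≡P = profile⇒≡P P A (n≤0⇒n≡0 c≤0) (trans (lower-inside A ∣A∣≡k) (trans (cong (k ∸_) (n≤0⇒n≡0 c≤0)) (sym ∣P∣≡k)))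
  walk-to-lower (suc i) A ∣A∣≡k isCeil =
    subst (λ l → Walk n k l P A) (cong suc (sym (+-suc i (i + 0))))
      (walk-snoc (walk-to-upper i B ∣B∣≡n∸k (subst (IsCeil i) (sym defect≡d) (isCeil-pred {i} isCeil)))
                 (inj₂ (∣A∣≡k , ∣B∣≡n∸k , A⊆B)))
    where
    c = defect lower A
    d = c ∸ t
    d≤k : d ≤ k
    d≤k = ≤-trans (m∸n≤m c t) (defect≤k lower A ∣A∣≡k)
    inside≤ : ∣ A ∩ P ∣ ≤ k ∸ d
    inside≤ = subst (_≤ k ∸ d) (sym (lower-inside A ∣A∣≡k)) (∸-monoʳ-≤ k (m∸n≤m c t))
    outside≤ : t + d ≤ ∣ ∁ P ∣
    outside≤ = subst (t + d ≤_) (sym (trans ∣∁P∣≡n∸k n∸k≡t+k)) (+-monoʳ-≤ t d≤k)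
    chosen = grow P A (k ∸ d) (t + d) inside≤ (subst (k ∸ d ≤_) (sym ∣P∣≡k) (m∸n≤m k d)) (m≤n+m∸n c t) outside≤
    B = proj₁ chosen
    A⊆B = proj₁ (proj₂ chosen)
    inside≡ : ∣ B ∩ P ∣ ≡ k ∸ d
    inside≡ = proj₁ (proj₂ (proj₂ chosen))
    defect≡d : defect upper B ≡ d
    defect≡d = trans (cong (k ∸_) inside≡) (m∸[m∸n]≡n d≤k)
    ∣B∣≡n∸k : ∣ B ∣ ≡ n ∸ k
    ∣B∣≡n∸k = trans (∣∣-split P B) (trans (cong₂ _+_ inside≡ (proj₂ (proj₂ (proj₂ chosen)))) (upper-size d d≤k))

  walk-to : ∀ A → IsVertex n k A → Walk n k (distance A) P A
  walk-to A (inj₁ ∣A∣≡k) = subst (λ l → Walk n k l P A) (sym (distance-on lower A ∣A∣≡k))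
    (walk-to-lower (ceilDiv (defect lower A) t) A ∣A∣≡k (ceilDiv-isCeil (defect lower A)))
  walk-to A (inj₂ ∣A∣≡n∸k) = subst (λ l → Walk n k l P A) (sym (distance-on upper A ∣A∣≡n∸k))
    (walk-to-upper (ceilDiv (defect upper A) t) A ∣A∣≡n∸k (ceilDiv-isCeil (defect upper A)))

  distance-P : distance P ≡ 0
  distance-P = begin
    distance P                          ≡⟨ distance-on lower P ∣P∣≡k ⟩
    2 * ceilDiv ∣ P ∩ ∁ P ∣ t            ≡⟨ cong (λ m → 2 * ceilDiv m t) (∣P∩∁P∣≡0 P) ⟩
    2 * ceilDiv 0 t                     ≡⟨ cong (2 *_) ceilDiv-zero ⟩
    0                                   ∎
    where open ≡-Reasoning

  walk-length : ∀ {l A} → Walk n k l P A → distance A ≤ l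
  walk-length {l} {A} w = subst (λ d → distance A ≤ d + l) distance-P (distance-walk w)

  Dist⇔distance : ∀ A x → IsVertex n k A → Dist n k P A x ⇔ distance A ≡ x
  Dist⇔distance A x vertex = mk⇔ to from
    where
    to : Dist n k P A x → distance A ≡ x
    to (w , no-shorter) with distance A <? x
    ... | yes shorter = contradiction (walk-to A vertex) (no-shorter (distance A) shorter)
    ... | no  ≮       = ≤-antisym (walk-length w) (≮⇒≥ ≮)
    from : distance A ≡ x → Dist n k P A x
    from refl = walk-to A vertex , λ m m<x w → <⇒≱ m<x (walk-length w)

  Shell : Layer → ℤ → Subset n → Set
  Shell ℓ m A = ∣ A ∣ ≡ layerSize ℓ × + defect ℓ A ≡ m

  shell? : ∀ ℓ m → Decidable (Shell ℓ m)
  shell? ℓ m A = (∣ A ∣ ℕ.≟ layerSize ℓ) ×-dec (+ defect ℓ A ℤ.≟ m)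

  shell : Layer → ℤ → List (Subset n)
  shell ℓ m = filter (shell? ℓ m) (subsets n)

  outsideCount : Layer → ℕ → ℕ
  outsideCount lower c = c
  outsideCount upper c = t + c

  shell⇔profile : ∀ ℓ c A → c ≤ k → Shell ℓ (+ c) A ⇔ Profile P (k ∸ c) (outsideCount ℓ c) A
  shell⇔profile lower c A c≤k = mk⇔
    (λ (∣A∣≡k , d≡c) → trans (lower-inside A ∣A∣≡k) (cong (k ∸_) (ℤ.+-injective d≡c)) , ℤ.+-injective d≡c)
    (λ (in≡ , out≡) → trans (∣∣-split P A) (trans (cong₂ _+_ in≡ out≡) (m∸n+n≡m c≤k)) , cong +_ out≡)
  shell⇔profile upper c A c≤k = mk⇔
    (λ (∣A∣≡n∸k , d≡c) →
       trans (sym (m∸[m∸n]≡n (∣∩P∣≤k A))) (cong (k ∸_) (ℤ.+-injective d≡c)) ,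
       trans (upper-outside A ∣A∣≡n∸k) (cong (λ d → t + d) (ℤ.+-injective d≡c)))
    (λ (in≡ , out≡) →
       trans (∣∣-split P A) (trans (cong₂ _+_ in≡ out≡) (upper-size c c≤k)) ,
       cong +_ (trans (cong (k ∸_) in≡) (m∸[m∸n]≡n c≤k)))

  -- The shell of defect m has C(k, k - m) C(n - k, outsideShift t ℓ m) elements,
  -- with the extended binomial coefficient absorbing m < 0 and m > k.
  ∣shell∣ : ∀ ℓ m → length (shell ℓ m) ≡ binomℤ (+ k) (+ k ℤ.- m) * binomℤ (+ (n ∸ k)) (outsideShift t ℓ m)
  ∣shell∣ ℓ -[1+ c ] =
    trans (length-filter-none (shell? ℓ -[1+ c ]) (λ { _ (_ , ()) }) (subsets n))
          (sym (cong (_* binomℤ (+ (n ∸ k)) (outsideShift t ℓ -[1+ c ])) (binomℤ-co-neg k c)))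
  ∣shell∣ ℓ (+ c) with c ≤? k
  ... | no c≰k =
    trans (length-filter-none (shell? ℓ (+ c))
             (λ A (sz , d≡c) → c≰k (subst (_≤ k) (ℤ.+-injective d≡c) (defect≤k ℓ A sz))) (subsets n))
          (sym (cong (_* binomℤ (+ (n ∸ k)) (outsideShift t ℓ (+ c))) (binomℤ-co-large k c (≰⇒> c≰k))))
  ... | yes c≤k = begin
    length (shell ℓ (+ c))
      ≡⟨ cong length (filter-≐ (shell? ℓ (+ c)) (profile? P (k ∸ c) (outsideCount ℓ c))
                       (to , from) (subsets n)) ⟩
    #profile P (k ∸ c) (outsideCount ℓ c)
      ≡⟨ #profile≡ P (k ∸ c) (outsideCount ℓ c) ⟩
    (∣ P ∣ C (k ∸ c)) * (∣ ∁ P ∣ C outsideCount ℓ c)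
      ≡⟨ cong₂ (λ a b → (a C (k ∸ c)) * (b C outsideCount ℓ c)) ∣P∣≡k ∣∁P∣≡n∸k ⟩
    (k C (k ∸ c)) * ((n ∸ k) C outsideCount ℓ c)
      ≡⟨ cong₂ _*_ (binomℤ-co k c c≤k) (binomℤ-ℕ (n ∸ k) (outsideCount ℓ c)) ⟨
    binomℤ (+ k) (+ k ℤ.- + c) * binomℤ (+ (n ∸ k)) (+ outsideCount ℓ c)
      ≡⟨ cong (λ m → binomℤ (+ k) (+ k ℤ.- + c) * binomℤ (+ (n ∸ k)) m) (outside-as-ℤ ℓ) ⟩
    binomℤ (+ k) (+ k ℤ.- + c) * binomℤ (+ (n ∸ k)) (outsideShift t ℓ (+ c)) ∎
    where
    open ≡-Reasoning
    to = λ {A} → Equivalence.to (shell⇔profile ℓ c A c≤k)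
    from = λ {A} → Equivalence.from (shell⇔profile ℓ c A c≤k)
    outside-as-ℤ : ∀ ℓ → + outsideCount ℓ c ≡ outsideShift t ℓ (+ c)
    outside-as-ℤ lower = refl
    outside-as-ℤ upper = refl

  layer-vertex : ∀ ℓ {A} → ∣ A ∣ ≡ layerSize ℓ → IsVertex n k A
  layer-vertex lower = inj₁
  layer-vertex upper = inj₂

  sphere⇔ : ∀ ℓ i A → (IsVertex n k A × Dist n k P A (parity ℓ + 2 * i))
                     ⇔ (∣ A ∣ ≡ layerSize ℓ × IsCeil i (defect ℓ A))
  sphere⇔ ℓ i A = mk⇔ to from
    where
    x = parity ℓ + 2 * i
    on-layer : ∀ ℓ′ → ∣ A ∣ ≡ layerSize ℓ′ → distance A ≡ x → ∣ A ∣ ≡ layerSize ℓ × IsCeil i (defect ℓ A)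
    on-layer ℓ′ sz d≡x with parity-split ℓ′ ℓ (ceilDiv (defect ℓ′ A) t) i (trans (sym (distance-on ℓ′ A sz)) d≡x)
    ... | refl , ceil≡i = sz , subst (λ c → IsCeil c (defect ℓ A)) ceil≡i (ceilDiv-isCeil (defect ℓ A))
    to : IsVertex n k A × Dist n k P A x → ∣ A ∣ ≡ layerSize ℓ × IsCeil i (defect ℓ A)
    to (vertex@(inj₁ sz) , dist) = on-layer lower sz (Equivalence.to (Dist⇔distance A x vertex) dist)
    to (vertex@(inj₂ sz) , dist) = on-layer upper sz (Equivalence.to (Dist⇔distance A x vertex) dist)
    vertex : ∣ A ∣ ≡ layerSize ℓ → IsVertex n k A
    vertex = layer-vertex ℓ {A}
    from : ∣ A ∣ ≡ layerSize ℓ × IsCeil i (defect ℓ A) → IsVertex n k A × Dist n k P A x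
    from (sz , isCeil) = vertex sz , Equivalence.from (Dist⇔distance A x (vertex sz))
      (trans (distance-on ℓ A sz) (cong (λ c → parity ℓ + 2 * c) (isCeil⇒ceilDiv {i} isCeil)))

  sphere : Layer → ℕ → List (Subset n)
  sphere ℓ i = concat (map (λ j → shell ℓ (slot t i (suc j))) (upTo t))

  ∈-sphere⇔ : ∀ ℓ i A → A ∈ sphere ℓ i ⇔ (IsVertex n k A × Dist n k P A (parity ℓ + 2 * i))
  ∈-sphere⇔ ℓ i A = mk⇔
    (λ A∈ → let (j , j∈ , A∈shell) = Equivalence.to (∈-concatMap⇔ F (upTo t)) A∈
                (sz , d≡slot) = proj₂ (∈-filter⁻ (shell? ℓ (slot t i (suc j))) {xs = subsets n} A∈shell)
            in Equivalence.from (sphere⇔ ℓ i A)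
                 (sz , Equivalence.from (isCeil⇔slot i (defect ℓ A)) (j , ∈-upTo⁻ j∈ , d≡slot)))
    (λ near → let (sz , isCeil) = Equivalence.to (sphere⇔ ℓ i A) near
                  (j , j<t , d≡slot) = Equivalence.to (isCeil⇔slot i (defect ℓ A)) isCeil
              in Equivalence.from (∈-concatMap⇔ F (upTo t))
                   (j , ∈-upTo⁺ j<t , ∈-filter⁺ (shell? ℓ (slot t i (suc j))) (∈-subsets A) (sz , d≡slot)))
    where
    F = λ j → shell ℓ (slot t i (suc j))

  sphere-unique : ∀ ℓ i → Unique (sphere ℓ i)
  sphere-unique ℓ i = concatMap-unique F (Unique.upTo⁺ t)
    (λ j → Unique.filter⁺ (shell? ℓ (slot t i (suc j))) (subsets-unique n))
    (λ {j} {j′} A∈ A∈′ → suc-injective (slot-injective i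
       (trans (sym (proj₂ (proj₂ (∈-filter⁻ (shell? ℓ (slot t i (suc j))) {xs = subsets n} A∈))))
              (proj₂ (proj₂ (∈-filter⁻ (shell? ℓ (slot t i (suc j′))) {xs = subsets n} A∈′))))))
    where
    F = λ j → shell ℓ (slot t i (suc j))

  ∣sphere∣ : ∀ ℓ i → length (sphere ℓ i) ≡ sphereCount n k t ℓ i
  ∣sphere∣ ℓ i = begin
    length (concat (map F (upTo t)))             ≡⟨ length-concat (map F (upTo t)) ⟩
    sum (map length (map F (upTo t)))           ≡⟨ cong sum (map-∘ (upTo t)) ⟨
    sum (map (λ j → length (F j)) (upTo t))     ≡⟨ cong sum (map-cong (λ j → ∣shell∣ ℓ (slot t i (suc j))) (upTo t)) ⟩
    sphereCount n k t ℓ i                       ∎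
    where
    open ≡-Reasoning
    F = λ j → shell ℓ (slot t i (suc j))

-- fAux n k x i is f(x + 2i); at x = parity ℓ it is γ(i) or δ(i), which is the sphere
-- count of layer ℓ at level i (for δ after rewriting i t + j as t + ((i-1) t + j)).
γδ≡sphereCount : ∀ n k ℓ i → fAux n k (parity ℓ) i ≡ sphereCount n k (tt n k) ℓ i
γδ≡sphereCount n k lower i = refl
γδ≡sphereCount n k upper i = cong sum (map-cong (λ j → cong (binomℤ (+ k) (+ k ℤ.- slot t i (suc j)) *_)
                                                     (cong (binomℤ (+ (n ∸ k))) (sym (t+slot t i (suc j)))))
                                                 (upTo t))
  where t = tt n k

parity-step : ∀ ℓ i → suc (suc (parity ℓ + 2 * i)) ≡ parity ℓ + 2 * suc i
parity-step lower i = sym (*-suc 2 i)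
parity-step upper i = cong suc (sym (*-suc 2 i))

fAux-shift : ∀ n k ℓ i j → fAux n k (parity ℓ + 2 * i) j ≡ fAux n k (parity ℓ) (i + j)
fAux-shift n k ℓ zero    j = cong (λ x → fAux n k x j) (+-identityʳ (parity ℓ))
fAux-shift n k ℓ (suc i) j = begin
  fAux n k (parity ℓ + 2 * suc i) j         ≡⟨ cong (λ x → fAux n k x j) (parity-step ℓ i) ⟨
  fAux n k (parity ℓ + 2 * i) (suc j)       ≡⟨ fAux-shift n k ℓ i (suc j) ⟩
  fAux n k (parity ℓ) (i + suc j)           ≡⟨ cong (fAux n k (parity ℓ)) (+-suc i j) ⟩
  fAux n k (parity ℓ) (suc i + j)           ∎
  where open ≡-Reasoning

f≡sphereCount : ∀ n k ℓ i → f n k (parity ℓ + 2 * i) ≡ sphereCount n k (tt n k) ℓ i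
f≡sphereCount n k ℓ i = begin
  fAux n k (parity ℓ + 2 * i) 0   ≡⟨ fAux-shift n k ℓ i 0 ⟩
  fAux n k (parity ℓ) (i + 0)     ≡⟨ cong (fAux n k (parity ℓ)) (+-identityʳ i) ⟩
  fAux n k (parity ℓ) i           ≡⟨ γδ≡sphereCount n k ℓ i ⟩
  sphereCount n k (tt n k) ℓ i    ∎
  where open ≡-Reasoning

halve : ∀ x → Σ Layer λ ℓ → Σ ℕ λ i → x ≡ parity ℓ + 2 * i
halve zero          = lower , 0 , refl
halve (suc zero)    = upper , 0 , refl
halve (suc (suc x)) with halve x
... | ℓ , i , refl = ℓ , suc i , parity-step ℓ i

∣Pset∣ : ∀ n k → k ≤ n → ∣ Pset n k ∣ ≡ k
∣Pset∣ n       zero    _         = none n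
  where
  none : ∀ n → ∣ Pset n 0 ∣ ≡ 0
  none zero    = refl
  none (suc n) = none n
∣Pset∣ (suc n) (suc k) (s≤s k≤n) = cong suc (∣Pset∣ n k k≤n)

positive-step : ∀ n k → k < n ∸ k → Σ ℕ λ s → tt n k ≡ suc s × n ∸ k ≡ suc s + k
positive-step n k k<n∸k with n ∸ k ∸ k in gap | m<n⇒0<n∸m k<n∸k
... | suc s | _ = s , trans t≡gap gap , sym (trans (cong (_+ k) (sym gap)) (m∸n+n≡m (<⇒≤ k<n∸k)))
  where
  t≡gap : tt n k ≡ n ∸ k ∸ k
  t≡gap = trans (cong (n ∸_) (cong (λ m → k + m) (+-identityʳ k))) (sym (∸-+-assoc n k k))

mainTheorem5 : (n k : ℕ) → k < n ∸ k →
    (x : ℕ) → x ≤ 2 * ceilDiv k (tt n k) + 1 →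
    Σ (List (Subset n)) λ L →
    Unique L
    × (∀ A → (A ∈ L) ⇔ (IsVertex n k A × Dist n k (Pset n k) A x))
    × length L ≡ f n k x
mainTheorem5 n k k<n∸k x _ with halve x | positive-step n k k<n∸k
... | ℓ , i , refl | s , t≡ , n∸k≡t+k =
  sphere ℓ i , sphere-unique ℓ i , ∈-sphere⇔ ℓ i ,
  trans (∣sphere∣ ℓ i) (sym (trans (f≡sphereCount n k ℓ i) (cong (λ t → sphereCount n k t ℓ i) t≡)))
  where
  k≤n = ≤-trans (<⇒≤ k<n∸k) (m∸n≤m n k)
  open DistancesFrom n k s (Pset n k) (∣Pset∣ n k k≤n) n∸k≡t+k
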